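{- Let $n,m\ge 2$ and $b,c\in\mathbb{N}$. If $P\big(\sum_{i=1}^m x_i^n=bc^n\big)=P\big(\sum_{i=1}^m x_i^n=b\big)$, then $P'\big(\sum_{i=1}^m x_i^n=bc^n\big)=P'\big(\sum_{i=1}^m x_i^n=b\big)$.
   Context: $P(f(x_1,\dots,x_m)=d)$ denotes the number of solutions $(x_1,\dots,x_m)$ in nonnegative integers, and $P'(f(x_1,\dots,x_m)=d)$ denotes the number of solutions with $x_1,\dots,x_m\in\mathbb{N}=\{1,2,\dots\}$. -}

module Defs where

open import Data.Nat using (ℕ; zero; suc; _+_; _^_; _≟_)
open import Data.List using (List; []; _∷_; map; concatMap; filter; length; upTo)
open import Data.Vec using (Vec; []; _∷_)

powSum : ∀ {m} → ℕ → Vec ℕ m → ℕ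
powSum n []       = 0
powSum n (x ∷ xs) = x ^ n + powSum n xs

vecsOver : List ℕ → (m : ℕ) → List (Vec ℕ m)
vecsOver xs zero    = [] ∷ []
vecsOver xs (suc m) = concatMap (λ x → map (x ∷_) (vecsOver xs m)) xs

-- P(∑_{i=1}^m x_i^n = d): number of solutions in nonnegative integers.
-- For n ≥ 1 every solution has x_i ≤ d, so enumerating entries in {0,…,d} is exhaustive.
P : (m n d : ℕ) → ℕ
P m n d = length (filter (λ v → powSum n v ≟ d) (vecsOver (upTo (suc d)) m))

P′ : (m n d : ℕ) → ℕ
P′ m n d = length (filter (λ v → powSum n v ≟ d) (vecsOver (map suc (upTo d)) m))

-- Split the nonnegative solutions into those with all entries positive (counted by P′) and
-- those with a zero entry. Multiplying every entry by c sends solutions for d injectively to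
-- solutions for d cⁿ and keeps each entry zero or positive, so neither class shrinks when d
-- becomes b cⁿ. Since P does not grow, neither class grows; in particular P′ stays the same.
module Submission where

open import Defs
open import Data.Nat
  using (ℕ; zero; suc; _≤_; _<_; _*_; _^_; _+_; _≟_; _<?_; z≤n; s≤s; z<s; NonZero)
open import Data.Nat.Properties
open import Data.Nat.Solver using (module +-*-Solver)
open import Data.List
  using (List; []; _∷_; _++_; map; concatMap; filter; length; upTo; cartesianProductWith)
open import Data.List.Properties using (length-map; length-removeAt′)
open import Data.List.Membership.Propositional using (_∈_; _─_)
open import Data.List.Membership.Propositional.Properties
  using ( ∈-map⁺; ∈-map⁻; ∈-filter⁺; ∈-filter⁻; ∈-upTo⁺
        ; ∈-cartesianProductWith⁺; ∈-cartesianProductWith⁻)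
open import Data.List.Relation.Binary.Subset.Propositional using (_⊆_)
open import Data.List.Relation.Unary.Any using (here; there)
import Data.List.Relation.Unary.All as All
open import Data.List.Relation.Unary.AllPairs using ([]; _∷_)
open import Data.List.Relation.Unary.Unique.Propositional using (Unique)
import Data.List.Relation.Unary.Unique.Propositional.Properties as Unique
open import Data.Vec as Vec using (Vec; []; _∷_)
open import Data.Vec.Properties using (∷-injective)
open import Data.Vec.Relation.Unary.All as VecAll using ([]; _∷_) renaming (All to AllV)
import Data.Vec.Relation.Unary.All.Properties as VecAllₚ
open import Data.Product using (_×_; _,_)
open import Level using (0ℓ)
open import Relation.Binary.PropositionalEquality
open import Relation.Nullary using (yes; no; contradiction)
open import Relation.Unary using (Pred; Decidable)
open import Relation.Unary.Properties using (∁?)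

∈-─ : ∀ {A : Set} {x y : A} {ys} (y∈ys : y ∈ ys) → x ∈ ys → x ≢ y → x ∈ ys ─ y∈ys
∈-─ (here refl) (here refl) x≢y = contradiction refl x≢y
∈-─ (here refl) (there x∈ys) _ = x∈ys
∈-─ (there _) (here refl) _ = here refl
∈-─ (there y∈ys) (there x∈ys) x≢y = there (∈-─ y∈ys x∈ys x≢y)

Unique∧⊆⇒length≤ : ∀ {A : Set} {xs ys : List A} → Unique xs → xs ⊆ ys → length xs ≤ length ys
Unique∧⊆⇒length≤ {xs = []} _ _ = z≤n
Unique∧⊆⇒length≤ {xs = x ∷ xs} {ys} (x∉xs ∷ xs!) xs⊆ys = begin
  suc (length xs)          ≤⟨ s≤s (Unique∧⊆⇒length≤ xs! xs⊆ys─x) ⟩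
  suc (length (ys ─ x∈ys)) ≡⟨ sym (length-removeAt′ ys _) ⟩
  length ys                ∎
  where
  open ≤-Reasoning
  x∈ys = xs⊆ys (here refl)
  xs⊆ys─x : xs ⊆ ys ─ x∈ys
  xs⊆ys─x z∈xs = ∈-─ x∈ys (xs⊆ys (there z∈xs)) (λ z≡x → All.lookup x∉xs z∈xs (sym z≡x))

Unique∧⊆∧⊇⇒length≡ : ∀ {A : Set} {xs ys : List A} → Unique xs → Unique ys →
  xs ⊆ ys → ys ⊆ xs → length xs ≡ length ys
Unique∧⊆∧⊇⇒length≡ xs! ys! xs⊆ys ys⊆xs =
  ≤-antisym (Unique∧⊆⇒length≤ xs! xs⊆ys) (Unique∧⊆⇒length≤ ys! ys⊆xs)

Unique∧injection⇒length≤ : ∀ {A B : Set} {xs : List A} {ys : List B} (f : A → B) →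
  (∀ {a b} → f a ≡ f b → a ≡ b) → Unique xs → (∀ {x} → x ∈ xs → f x ∈ ys) →
  length xs ≤ length ys
Unique∧injection⇒length≤ {xs = xs} f f-inj xs! f[xs]⊆ys =
  subst (_≤ _) (length-map f xs) (Unique∧⊆⇒length≤ (Unique.map⁺ f-inj xs!) map-f⊆ys)
  where
  map-f⊆ys : map f xs ⊆ _
  map-f⊆ys y∈map with _ , x∈xs , refl ← ∈-map⁻ f y∈map = f[xs]⊆ys x∈xs

length-filter+length-filter-∁ : ∀ {A : Set} {R : Pred A 0ℓ} (R? : Decidable R) xs →
  length (filter R? xs) + length (filter (∁? R?) xs) ≡ length xs
length-filter+length-filter-∁ R? [] = refl
length-filter+length-filter-∁ R? (x ∷ xs) with R? x
... | yes _ = cong suc (length-filter+length-filter-∁ R? xs)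
... | no _  = trans (+-suc _ _) (cong suc (length-filter+length-filter-∁ R? xs))

m≤o⇒n≤p⇒m+n≡o+p⇒m≡o : ∀ {m n o p} → m ≤ o → n ≤ p → m + n ≡ o + p → m ≡ o
m≤o⇒n≤p⇒m+n≡o+p⇒m≡o {m} {n} {o} {p} m≤o n≤p m+n≡o+p = ≤-antisym m≤o (+-cancelʳ-≤ n o m (begin
  o + n ≤⟨ +-monoʳ-≤ o n≤p ⟩
  o + p ≡⟨ sym m+n≡o+p ⟩
  m + n ∎))
  where open ≤-Reasoning

^-distribʳ-* : ∀ m n o → (m * n) ^ o ≡ m ^ o * n ^ o
^-distribʳ-* m n zero = refl
^-distribʳ-* m n (suc o) = begin
  m * n * (m * n) ^ o     ≡⟨ cong (m * n *_) (^-distribʳ-* m n o) ⟩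
  m * n * (m ^ o * n ^ o) ≡⟨ solve 4 (λ m n x y → m :* n :* (x :* y) := m :* x :* (n :* y))
                                     refl m n (m ^ o) (n ^ o) ⟩
  m * m ^ o * (n * n ^ o) ∎
  where
  open ≡-Reasoning
  open +-*-Solver

m≤m^n : ∀ m n .{{_ : NonZero n}} → m ≤ m ^ n
m≤m^n zero (suc n) = z≤n
m≤m^n (suc m) (suc n) = m≤m*n (suc m) (suc m ^ n) {{m^n≢0 (suc m) n}}

Vec-map-injective : ∀ {A B : Set} {k} {f : A → B} → (∀ {x y} → f x ≡ f y → x ≡ y) →
  {xs ys : Vec A k} → Vec.map f xs ≡ Vec.map f ys → xs ≡ ys
Vec-map-injective f-inj {[]} {[]} _ = refl
Vec-map-injective f-inj {_ ∷ _} {_ ∷ _} fxs≡fys with fx≡fy , fxs≡fys ← ∷-injective fxs≡fys =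
  cong₂ _∷_ (f-inj fx≡fy) (Vec-map-injective f-inj fxs≡fys)

concatMap-∷≡cartesianProductWith : ∀ {A : Set} {m} (xs : List A) (vs : List (Vec A m)) →
  concatMap (λ x → map (x ∷_) vs) xs ≡ cartesianProductWith _∷_ xs vs
concatMap-∷≡cartesianProductWith [] vs = refl
concatMap-∷≡cartesianProductWith (x ∷ xs) vs =
  cong (map (x ∷_) vs ++_) (concatMap-∷≡cartesianProductWith xs vs)

vecsOver-suc : ∀ xs m → vecsOver xs (suc m) ≡ cartesianProductWith _∷_ xs (vecsOver xs m)
vecsOver-suc xs m = concatMap-∷≡cartesianProductWith xs (vecsOver xs m)

vecsOver-unique : ∀ {xs} → Unique xs → ∀ m → Unique (vecsOver xs m)
vecsOver-unique xs! zero = All.[] ∷ []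
vecsOver-unique {xs} xs! (suc m) = subst Unique (sym (vecsOver-suc xs m))
  (Unique.cartesianProductWith⁺ _∷_ ∷-injective xs! (vecsOver-unique xs! m))

∈-vecsOver⁺ : ∀ {xs m} {v : Vec ℕ m} → AllV (_∈ xs) v → v ∈ vecsOver xs m
∈-vecsOver⁺ [] = here refl
∈-vecsOver⁺ {xs} {suc m} (x∈xs ∷ v∈xs) = subst (_ ∈_) (sym (vecsOver-suc xs m))
  (∈-cartesianProductWith⁺ _∷_ x∈xs (∈-vecsOver⁺ v∈xs))

∈-vecsOver⁻ : ∀ {xs m} {v : Vec ℕ m} → v ∈ vecsOver xs m → AllV (_∈ xs) v
∈-vecsOver⁻ {v = []} _ = []
∈-vecsOver⁻ {xs} {suc m} v∈ with _ , _ , x∈xs , w∈ , refl ←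
  ∈-cartesianProductWith⁻ _∷_ xs (vecsOver xs m) (subst (_ ∈_) (vecsOver-suc xs m) v∈) =
  x∈xs ∷ ∈-vecsOver⁻ w∈

solutions : (m n : ℕ) → List ℕ → ℕ → List (Vec ℕ m)
solutions m n xs d = filter (λ v → powSum n v ≟ d) (vecsOver xs m)

solutions-unique : ∀ {m n xs d} → Unique xs → Unique (solutions m n xs d)
solutions-unique {m} xs! = Unique.filter⁺ _ (vecsOver-unique xs! m)

∈-solutions⁺ : ∀ {m n xs d} {v : Vec ℕ m} → AllV (_∈ xs) v → powSum n v ≡ d →
  v ∈ solutions m n xs d
∈-solutions⁺ {n = n} {d = d} v∈xs = ∈-filter⁺ (λ v → powSum n v ≟ d) (∈-vecsOver⁺ v∈xs)

∈-solutions⁻ : ∀ {m n xs d} {v : Vec ℕ m} → v ∈ solutions m n xs d →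
  AllV (_∈ xs) v × powSum n v ≡ d
∈-solutions⁻ {m} {n} {xs} {d} v∈
  with v∈vecs , v-sol ← ∈-filter⁻ (λ v → powSum n v ≟ d) {xs = vecsOver xs m} v∈ =
  ∈-vecsOver⁻ v∈vecs , v-sol

entries≤powSum : ∀ {k} n .{{_ : NonZero n}} (v : Vec ℕ k) → AllV (_≤ powSum n v) v
entries≤powSum n [] = []
entries≤powSum n (x ∷ v) = ≤-trans (m≤m^n x n) (m≤m+n _ _)
  ∷ VecAll.map (λ y≤ → ≤-trans y≤ (m≤n+m _ _)) (entries≤powSum n v)

powSum-map-*ʳ : ∀ {k} n c (v : Vec ℕ k) → powSum n (Vec.map (_* c) v) ≡ powSum n v * c ^ n
powSum-map-*ʳ n c [] = refl
powSum-map-*ʳ n c (x ∷ v) = begin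
  (x * c) ^ n + powSum n (Vec.map (_* c) v) ≡⟨ cong₂ _+_ (^-distribʳ-* x c n)
                                                        (powSum-map-*ʳ n c v) ⟩
  x ^ n * c ^ n + powSum n v * c ^ n        ≡⟨ sym (*-distribʳ-+ (c ^ n) (x ^ n) _) ⟩
  (x ^ n + powSum n v) * c ^ n              ∎
  where open ≡-Reasoning

Positive : ∀ {k} → Pred (Vec ℕ k) 0ℓ
Positive = AllV (0 <_)

positive? : ∀ {k} → Decidable (Positive {k})
positive? = VecAll.all? (0 <?_)

positive-map-*ʳ⁺ : ∀ {k} c .{{_ : NonZero c}} {v : Vec ℕ k} →
  Positive v → Positive (Vec.map (_* c) v)
positive-map-*ʳ⁺ (suc _) v>0 = VecAllₚ.map⁺ (VecAll.map (λ { {suc _} _ → z<s }) v>0)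

positive-map-*ʳ⁻ : ∀ {k} c {v : Vec ℕ k} → Positive (Vec.map (_* c) v) → Positive v
positive-map-*ʳ⁻ c cv>0 = VecAll.map (λ { {suc _} _ → z<s ; {zero} () }) (VecAllₚ.map⁻ cv>0)

∈-map-suc-upTo⁺ : ∀ {x d} → 0 < x → x ≤ d → x ∈ map suc (upTo d)
∈-map-suc-upTo⁺ {suc x} _ x≤d = ∈-map⁺ suc (∈-upTo⁺ x≤d)

∈-map-suc-upTo⁻ : ∀ {x d} → x ∈ map suc (upTo d) → 0 < x
∈-map-suc-upTo⁻ x∈ with _ , _ , refl ← ∈-map⁻ suc x∈ = z<s

nonnegativeSolutions : (m n d : ℕ) → List (Vec ℕ m)
nonnegativeSolutions m n d = solutions m n (upTo (suc d)) d

P⁰ : (m n d : ℕ) → ℕ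
P⁰ m n d = length (filter (∁? positive?) (nonnegativeSolutions m n d))

module Counting (m n : ℕ) .{{_ : NonZero n}} where

  ∈-nonnegativeSolutions : ∀ {d} {v : Vec ℕ m} → powSum n v ≡ d → v ∈ nonnegativeSolutions m n d
  ∈-nonnegativeSolutions {v = v} refl =
    ∈-solutions⁺ (VecAll.map (λ x≤ → ∈-upTo⁺ (s≤s x≤)) (entries≤powSum n v)) refl

  count-map-*ʳ-mono : {R : Pred (Vec ℕ m) 0ℓ} (R? : Decidable R) (c : ℕ) .{{_ : NonZero c}} →
    (∀ {v} → R v → R (Vec.map (_* c) v)) → ∀ d →
    length (filter R? (nonnegativeSolutions m n d))
      ≤ length (filter R? (nonnegativeSolutions m n (d * c ^ n)))
  count-map-*ʳ-mono R? c R-map d = Unique∧injection⇒length≤ (Vec.map (_* c))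
    (Vec-map-injective (*-cancelʳ-≡ _ _ c))
    (Unique.filter⁺ R? (solutions-unique (Unique.upTo⁺ (suc d))))
    scaled∈
    where
    scaled∈ : ∀ {v} → v ∈ filter R? (nonnegativeSolutions m n d) →
      Vec.map (_* c) v ∈ filter R? (nonnegativeSolutions m n (d * c ^ n))
    scaled∈ {v} v∈ with v∈sols , Rv ← ∈-filter⁻ R? v∈ with _ , refl ← ∈-solutions⁻ v∈sols =
      ∈-filter⁺ R? (∈-nonnegativeSolutions (powSum-map-*ʳ n c v)) (R-map Rv)

  P′≡count-positive : ∀ d → P′ m n d ≡ length (filter positive? (nonnegativeSolutions m n d))
  P′≡count-positive d = Unique∧⊆∧⊇⇒length≡
    (solutions-unique (Unique.map⁺ suc-injective (Unique.upTo⁺ d)))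
    (Unique.filter⁺ positive? (solutions-unique (Unique.upTo⁺ (suc d))))
    positive⊆ positive⊇
    where
    positive⊆ : solutions m n (map suc (upTo d)) d
              ⊆ filter positive? (nonnegativeSolutions m n d)
    positive⊆ v∈ with v∈xs , refl ← ∈-solutions⁻ v∈ =
      ∈-filter⁺ positive? (∈-nonnegativeSolutions refl) (VecAll.map ∈-map-suc-upTo⁻ v∈xs)
    positive⊇ : filter positive? (nonnegativeSolutions m n d)
              ⊆ solutions m n (map suc (upTo d)) d
    positive⊇ {v} v∈ with v∈sols , v>0 ← ∈-filter⁻ positive? v∈
                     with _ , refl ← ∈-solutions⁻ v∈sols =
      ∈-solutions⁺ (VecAll.map (λ (x>0 , x≤) → ∈-map-suc-upTo⁺ x>0 x≤)
                               (VecAll.zip (v>0 , entries≤powSum n v))) refl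

  P≡P′+P⁰ : ∀ d → P m n d ≡ P′ m n d + P⁰ m n d
  P≡P′+P⁰ d = trans (sym (length-filter+length-filter-∁ positive? (nonnegativeSolutions m n d)))
    (cong (_+ P⁰ m n d) (sym (P′≡count-positive d)))

  P′-mono-*-^ : ∀ c .{{_ : NonZero c}} d → P′ m n d ≤ P′ m n (d * c ^ n)
  P′-mono-*-^ c d = subst₂ _≤_ (sym (P′≡count-positive d)) (sym (P′≡count-positive (d * c ^ n)))
    (count-map-*ʳ-mono positive? c (positive-map-*ʳ⁺ c) d)

  P⁰-mono-*-^ : ∀ c .{{_ : NonZero c}} d → P⁰ m n d ≤ P⁰ m n (d * c ^ n)
  P⁰-mono-*-^ c = count-map-*ʳ-mono (∁? positive?) c (λ v≯0 cv>0 → v≯0 (positive-map-*ʳ⁻ c cv>0))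

proposition4 : (n m b c : ℕ) → 2 ≤ n → 2 ≤ m → 1 ≤ b → 1 ≤ c →
    P m n (b * c ^ n) ≡ P m n b →
    P′ m n (b * c ^ n) ≡ P′ m n b
proposition4 n m b c (s≤s (s≤s _)) _ _ (s≤s _) P-eq =
  sym (m≤o⇒n≤p⇒m+n≡o+p⇒m≡o (P′-mono-*-^ c b) (P⁰-mono-*-^ c b) (begin
    P′ m n b + P⁰ m n b                     ≡⟨ sym (P≡P′+P⁰ b) ⟩
    P m n b                                 ≡⟨ sym P-eq ⟩
    P m n (b * c ^ n)                       ≡⟨ P≡P′+P⁰ (b * c ^ n) ⟩
    P′ m n (b * c ^ n) + P⁰ m n (b * c ^ n) ∎))
  where
  open Counting m n
  open ≡-Reasoning
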